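{- Let $t \ge 2$ and $m \ge 2t$ be integers, and let $x$ be an integer with $F_{m-2t+1} \le x < F_{m-2t+3}$. Set \[ (\varepsilon, y) = \begin{cases} (1,\, x - F_{m-2t+2}) & \text{if } F_{m-2t+2} \le x < F_{m-2t+3},\\ (0,\, x - F_{m-2t+1}) & \text{if } F_{m-2t+1} \le x < F_{m-2t+2}. \end{cases} \] Then \[ A(F_m + x) = t A(x) - \varepsilon A(y) + f(t)\, 2^{m-2t}. \]
   Context: The Fibonacci numbers are $F_1 = F_2 = 1$, $F_{m+1} = F_m + F_{m-1}$. For $n \in \mathbb{Z}_{\ge 0}$, $R(n)$ is the number of solutions to $x_1 + \cdots + x_s = n$ with $s \in \mathbb{Z}_{\ge 0}$ and $x_1 < \cdots < x_s$ Fibonacci numbers (partitions of $n$ into distinct Fibonacci numbers; $R(0)=1$). For $H \in \mathbb{Z}$, $A(H) = \sum_{n=0}^{H} R(n)$ (so $A(H)=0$ for $H<0$). For $t \in \mathbb{N}$, $f(t) = 1 + \frac{2(4^{t-1} - 1)}{3}$. -}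

module Defs where

open import Data.Nat using (ℕ; zero; suc; _+_; _*_; _∸_; _^_; _≤?_; _/_)
open import Data.Bool using (Bool; true; false)
open import Relation.Nullary using (yes; no)

-- Fibonacci numbers: fib 1 = fib 2 = 1, fib (m+2) = fib (m+1) + fib m
-- (fib 0 = 0 is only a convenience value; it is never used as a part).
fib : ℕ → ℕ
fib zero = zero
fib (suc zero) = suc zero
fib (suc (suc m)) = fib (suc m) + fib m

-- reps k n = number of subsets S of the set of VALUES {F_2, F_3, ..., F_{k+1}}
-- with sum S = n.  (F_1 = F_2 = 1 is one Fibonacci number, so the distinct
-- Fibonacci numbers are exactly F_2 < F_3 < F_4 < ....)
reps : ℕ → ℕ → ℕ
reps zero zero = 1
reps zero (suc n) = 0
reps (suc k) n with fib (suc (suc k)) ≤? n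
... | yes _ = reps k n + reps k (n ∸ fib (suc (suc k)))
... | no _ = reps k n

-- R n: number of partitions of n into distinct Fibonacci numbers.
-- Every Fibonacci number ≤ n is among F_2,...,F_{n+1} since F_{n+2} > n.
R : ℕ → ℕ
R n = reps (suc n) n

A : ℕ → ℕ
A zero = R zero
A (suc H) = A H + R (suc H)

-- f t = 1 + 2 (4^(t-1) - 1) / 3   (the division is exact)
f : ℕ → ℕ
f t = 1 + (2 * (4 ^ (t ∸ 1) ∸ 1)) / 3

-- Let C k H = cumReps k H be the number of subsets of {F₂, …, F_{k+1}} with sum at most H, so that
-- A H = C k H as soon as H < F_{k+2}. Splitting on whether F_{k+2} is used gives
-- C (k+1) H = C k H + C k (H − F_{k+2}), and since F₂ + ⋯ + F_{k+1} = F_{k+3} − 2 we have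
-- C k H = 2^k once H ≥ F_{k+3} − 2. Two such splits give the two-step recursion
-- C (p+2) (F_{p+3} + y) = 2^p + C p (F_{p+1} + y) + A y  (y < F_{p+3}).
-- Unfolding it t − 1 times from A (F_m + x) = C (m−1) (F_m + x) down to d = m − 2t yields
-- (t − 1) A x + 2^d (1 + 2 + 2·4 + ⋯ + 2·4^{t−2}) + C d x = (t − 1) A x + f t 2^d + C d x,
-- and one more split shows C d x = A x − ε A y.
module Submission where

open import Defs
open import Data.Nat using (ℕ; zero; suc; _+_; _*_; _∸_; _^_; _/_; _≤_; _<_; _≤′_; ≤′-refl; ≤′-step; z≤n; s≤s; _≤?_)
open import Data.Nat.Properties
open import Data.Nat.DivMod using (m*n/n≡m)
open import Data.Nat.Tactic.RingSolver using (solve-∀)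
open import Data.Integer using (ℤ; +_; _-_) renaming (_+_ to _+ℤ_; _*_ to _*ℤ_)
import Data.Integer.Properties as ℤ
import Data.Integer.Tactic.RingSolver as ℤ-Solver
open import Data.Product using (Σ; _×_; _,_)
open import Relation.Nullary using (yes; no)
open import Relation.Nullary.Negation using (contradiction)
open import Relation.Binary.PropositionalEquality using (_≡_; refl; sym; trans; cong; cong₂; subst; module ≡-Reasoning)

open ≡-Reasoning

fib-≤-suc : ∀ n → fib n ≤ fib (suc n)
fib-≤-suc zero = z≤n
fib-≤-suc (suc n) = m≤m+n _ _

fib-mono : ∀ {m n} → m ≤ n → fib m ≤ fib n
fib-mono m≤n = go (≤⇒≤′ m≤n)
  where
  go : ∀ {m n} → m ≤′ n → fib m ≤ fib n
  go ≤′-refl = ≤-refl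
  go (≤′-step {n} p) = ≤-trans (go p) (fib-≤-suc n)

n<fib[2+n] : ∀ n → n < fib (2 + n)
n<fib[2+n] zero = s≤s z≤n
n<fib[2+n] (suc n) =
  ≤-trans (≤-reflexive (+-comm 1 (suc n))) (+-mono-≤ (n<fib[2+n] n) (fib-mono {1} {suc n} (s≤s z≤n)))

prefixSum : (ℕ → ℕ) → ℕ → ℕ
prefixSum r zero = r 0
prefixSum r (suc H) = prefixSum r H + r (suc H)

prefixSum-cong : ∀ {r r′} H → (∀ n → n ≤ H → r n ≡ r′ n) → prefixSum r H ≡ prefixSum r′ H
prefixSum-cong zero r≡r′ = r≡r′ 0 z≤n
prefixSum-cong (suc H) r≡r′ =
  cong₂ _+_ (prefixSum-cong H (λ n n≤H → r≡r′ n (m≤n⇒m≤1+n n≤H))) (r≡r′ (suc H) ≤-refl)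

prefixSum-+ : ∀ r r′ H → prefixSum (λ n → r n + r′ n) H ≡ prefixSum r H + prefixSum r′ H
prefixSum-+ r r′ zero = refl
prefixSum-+ r r′ (suc H) = begin
  prefixSum (λ n → r n + r′ n) H + (r (suc H) + r′ (suc H))
    ≡⟨ cong (_+ (r (suc H) + r′ (suc H))) (prefixSum-+ r r′ H) ⟩
  prefixSum r H + prefixSum r′ H + (r (suc H) + r′ (suc H))
    ≡⟨ interchange (prefixSum r H) (prefixSum r′ H) (r (suc H)) (r′ (suc H)) ⟩
  prefixSum r H + r (suc H) + (prefixSum r′ H + r′ (suc H)) ∎
  where
  interchange : ∀ a b c d → a + b + (c + d) ≡ a + c + (b + d)
  interchange = solve-∀

shiftBy : ℕ → (ℕ → ℕ) → ℕ → ℕ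
shiftBy F r n with F ≤? n
... | yes _ = r (n ∸ F)
... | no _ = 0

shiftBy-≥ : ∀ F r {n} → F ≤ n → shiftBy F r n ≡ r (n ∸ F)
shiftBy-≥ F r {n} F≤n with F ≤? n
... | yes _ = refl
... | no F≰n = contradiction F≤n F≰n

shiftBy-< : ∀ F r {n} → n < F → shiftBy F r n ≡ 0
shiftBy-< F r {n} n<F with F ≤? n
... | yes F≤n = contradiction n<F (≤⇒≯ F≤n)
... | no _ = refl

prefixSum-shiftBy-< : ∀ F r {H} → H < F → prefixSum (shiftBy F r) H ≡ 0
prefixSum-shiftBy-< F r {zero} 0<F = shiftBy-< F r 0<F
prefixSum-shiftBy-< F r {suc H} H<F =
  cong₂ _+_ (prefixSum-shiftBy-< F r (<-trans (n<1+n H) H<F)) (shiftBy-< F r H<F)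

prefixSum-shiftBy-+ : ∀ F r j → prefixSum (shiftBy F r) (F + j) ≡ prefixSum r j
prefixSum-shiftBy-+ zero r j = prefixSum-cong j (λ n _ → shiftBy-≥ 0 r z≤n)
prefixSum-shiftBy-+ (suc F) r zero = begin
  prefixSum (shiftBy (suc F) r) (F + 0) + shiftBy (suc F) r (suc F + 0)
    ≡⟨ cong₂ _+_ (prefixSum-shiftBy-< (suc F) r (s≤s (≤-reflexive (+-identityʳ F))))
                 (shiftBy-≥ (suc F) r (≤-reflexive (sym (+-identityʳ (suc F))))) ⟩
  r (suc F + 0 ∸ suc F)
    ≡⟨ cong r (m+n∸m≡n (suc F) 0) ⟩
  r 0 ∎
prefixSum-shiftBy-+ (suc F) r (suc j) = begin
  prefixSum (shiftBy (suc F) r) (suc F + suc j)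
    ≡⟨ cong (prefixSum (shiftBy (suc F) r)) (+-suc (suc F) j) ⟩
  prefixSum (shiftBy (suc F) r) (suc F + j) + shiftBy (suc F) r (suc (suc F + j))
    ≡⟨ cong₂ _+_ (prefixSum-shiftBy-+ (suc F) r j) (shiftBy-≥ (suc F) r (m≤n⇒m≤1+n (m≤m+n (suc F) j))) ⟩
  prefixSum r j + r (suc (suc F + j) ∸ suc F)
    ≡⟨ cong (λ n → prefixSum r j + r n) (trans (cong (_∸ suc F) (sym (+-suc (suc F) j))) (m+n∸m≡n (suc F) (suc j))) ⟩
  prefixSum r j + r (suc j) ∎

reps-suc : ∀ k n → reps (suc k) n ≡ reps k n + shiftBy (fib (2 + k)) (reps k) n
reps-suc k n with fib (2 + k) ≤? n
... | yes _ = refl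
... | no _ = sym (+-identityʳ _)

reps-stable : ∀ {k k′ n} → n < fib (2 + k) → k ≤ k′ → reps k′ n ≡ reps k n
reps-stable {k} {n = n} n<F k≤k′ = go (≤⇒≤′ k≤k′)
  where
  go : ∀ {k′} → k ≤′ k′ → reps k′ n ≡ reps k n
  go ≤′-refl = refl
  go {suc k′} (≤′-step p) = begin
    reps (suc k′) n
      ≡⟨ reps-suc k′ n ⟩
    reps k′ n + shiftBy (fib (2 + k′)) (reps k′) n
      ≡⟨ cong (_+_ (reps k′ n)) (shiftBy-< (fib (2 + k′)) (reps k′) (<-≤-trans n<F (fib-mono (s≤s (s≤s (≤′⇒≤ p)))))) ⟩
    reps k′ n + 0
      ≡⟨ +-identityʳ _ ⟩
    reps k′ n
      ≡⟨ go p ⟩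
    reps k n ∎

cumReps : ℕ → ℕ → ℕ
cumReps k = prefixSum (reps k)

cumReps-zero : ∀ H → cumReps 0 H ≡ 1
cumReps-zero zero = refl
cumReps-zero (suc H) = trans (+-identityʳ _) (cumReps-zero H)

cumReps-suc : ∀ k H → cumReps (suc k) H ≡ cumReps k H + prefixSum (shiftBy (fib (2 + k)) (reps k)) H
cumReps-suc k H = trans (prefixSum-cong H (λ n _ → reps-suc k n)) (prefixSum-+ _ _ H)

cumReps-suc-≥ : ∀ k {H} → fib (2 + k) ≤ H → cumReps (suc k) H ≡ cumReps k H + cumReps k (H ∸ fib (2 + k))
cumReps-suc-≥ k {H} F≤H = begin
  cumReps (suc k) H
    ≡⟨ cumReps-suc k H ⟩
  cumReps k H + prefixSum (shiftBy F (reps k)) H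
    ≡⟨ cong (λ n → cumReps k H + prefixSum (shiftBy F (reps k)) n) (sym (m+[n∸m]≡n F≤H)) ⟩
  cumReps k H + prefixSum (shiftBy F (reps k)) (F + (H ∸ F))
    ≡⟨ cong (_+_ (cumReps k H)) (prefixSum-shiftBy-+ F (reps k) (H ∸ F)) ⟩
  cumReps k H + cumReps k (H ∸ F) ∎
  where F = fib (2 + k)

A≡prefixSum-R : ∀ H → A H ≡ prefixSum R H
A≡prefixSum-R zero = refl
A≡prefixSum-R (suc H) = cong (_+ R (suc H)) (A≡prefixSum-R H)

A≡cumReps : ∀ k {H} → H < fib (2 + k) → A H ≡ cumReps k H
A≡cumReps k {H} H<F = trans (A≡prefixSum-R H) (prefixSum-cong H R≡reps)
  where
  R≡reps : ∀ n → n ≤ H → R n ≡ reps k n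
  R≡reps n n≤H = begin
    reps (suc n) n   ≡⟨ reps-stable (n<fib[2+n] n) (n≤1+n n) ⟩
    reps n n         ≡⟨ reps-stable (n<fib[2+n] n) (m≤n+m n k) ⟨
    reps (k + n) n   ≡⟨ reps-stable (≤-<-trans n≤H H<F) (m≤m+n k n) ⟩
    reps k n ∎

cumReps-full : ∀ k {H} → fib (3 + k) ≤ H + 2 → cumReps k H ≡ 2 ^ k
cumReps-full zero {H} _ = cumReps-zero H
cumReps-full (suc k) {H} F≤H+2 = begin
  cumReps (suc k) H                           ≡⟨ cumReps-suc-≥ k F₂₊ₖ≤H ⟩
  cumReps k H + cumReps k (H ∸ fib (2 + k))   ≡⟨ cong₂ _+_ (cumReps-full k (≤-trans (m≤m+n _ _) F≤H+2))
                                                             (cumReps-full k F₃₊ₖ≤H∸F₂₊ₖ+2) ⟩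
  2 ^ k + 2 ^ k                               ≡⟨ cong (_+_ (2 ^ k)) (sym (+-identityʳ (2 ^ k))) ⟩
  2 ^ suc k ∎
  where
  2≤F₃₊ₖ : 2 ≤ fib (3 + k)
  2≤F₃₊ₖ = ≤-trans (s≤s (s≤s z≤n)) (n<fib[2+n] (suc k))
  F₂₊ₖ≤H : fib (2 + k) ≤ H
  F₂₊ₖ≤H = +-cancelʳ-≤ 2 _ H (≤-trans (+-monoʳ-≤ (fib (2 + k)) 2≤F₃₊ₖ)
                                 (≤-trans (≤-reflexive (+-comm (fib (2 + k)) (fib (3 + k)))) F≤H+2))
  F₃₊ₖ≤H∸F₂₊ₖ+2 : fib (3 + k) ≤ H ∸ fib (2 + k) + 2
  F₃₊ₖ≤H∸F₂₊ₖ+2 = ≤-trans (m+n≤o⇒m≤o∸n _ F≤H+2) (≤-reflexive (+-∸-comm 2 F₂₊ₖ≤H))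

cumReps-fib-+ : ∀ p y → cumReps (2 + p) (fib (3 + p) + y) ≡ 2 ^ p + cumReps p (fib (1 + p) + y) + cumReps (1 + p) y
cumReps-fib-+ p y = begin
  cumReps (2 + p) H
    ≡⟨ cumReps-suc-≥ (1 + p) (m≤m+n _ y) ⟩
  cumReps (1 + p) H + cumReps (1 + p) (H ∸ fib (3 + p))
    ≡⟨ cong₂ _+_ (cumReps-suc-≥ p (≤-trans (m≤m+n _ _) (m≤m+n _ y))) (cong (cumReps (1 + p)) (m+n∸m≡n (fib (3 + p)) y)) ⟩
  cumReps p H + cumReps p (H ∸ fib (2 + p)) + cumReps (1 + p) y
    ≡⟨ cong₂ (λ a b → a + cumReps p b + cumReps (1 + p) y)
             (cumReps-full p (≤-trans (m≤m+n _ y) (m≤m+n H 2))) H∸F₂₊ₚ≡F₁₊ₚ+y ⟩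
  2 ^ p + cumReps p (fib (1 + p) + y) + cumReps (1 + p) y ∎
  where
  H = fib (3 + p) + y
  H∸F₂₊ₚ≡F₁₊ₚ+y : H ∸ fib (2 + p) ≡ fib (1 + p) + y
  H∸F₂₊ₚ≡F₁₊ₚ+y = trans (cong (_∸ fib (2 + p)) (+-assoc (fib (2 + p)) (fib (1 + p)) y)) (m+n∸m≡n (fib (2 + p)) _)

4^-mod-3 : ∀ s → Σ ℕ λ q → 4 ^ s ≡ 1 + q * 3
4^-mod-3 zero = 0 , refl
4^-mod-3 (suc s) with 4^-mod-3 s
... | q , 4^s≡1+3q = 1 + 4 * q , trans (cong (4 *_) 4^s≡1+3q) (identity q)
  where
  identity : ∀ q → 4 * (1 + q * 3) ≡ 1 + (1 + 4 * q) * 3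
  identity = solve-∀

3*f-closed : ∀ s → 3 * f (suc s) ≡ 1 + 2 * 4 ^ s
3*f-closed s with 4^-mod-3 s
... | q , 4^s≡1+3q = begin
  3 * (1 + 2 * (4 ^ s ∸ 1) / 3)    ≡⟨ cong (λ n → 3 * (1 + 2 * (n ∸ 1) / 3)) 4^s≡1+3q ⟩
  3 * (1 + 2 * (q * 3) / 3)        ≡⟨ cong (λ n → 3 * (1 + n / 3)) (sym (*-assoc 2 q 3)) ⟩
  3 * (1 + 2 * q * 3 / 3)          ≡⟨ cong (λ n → 3 * (1 + n)) (m*n/n≡m (2 * q) 3) ⟩
  3 * (1 + 2 * q)                  ≡⟨ identity q ⟩
  1 + 2 * (1 + q * 3)              ≡⟨ cong (λ n → 1 + 2 * n) 4^s≡1+3q ⟨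
  1 + 2 * 4 ^ s ∎
  where
  identity : ∀ q → 3 * (1 + 2 * q) ≡ 1 + 2 * (1 + q * 3)
  identity = solve-∀

f-suc : ∀ s → f (2 + s) ≡ f (1 + s) + 2 * 4 ^ s
f-suc s = *-cancelˡ-≡ _ _ 3 (begin
  3 * f (2 + s)                       ≡⟨ 3*f-closed (suc s) ⟩
  1 + 2 * (4 * 4 ^ s)                 ≡⟨ identity (4 ^ s) ⟩
  1 + 2 * 4 ^ s + 3 * (2 * 4 ^ s)     ≡⟨ cong (_+ 3 * (2 * 4 ^ s)) (3*f-closed s) ⟨
  3 * f (1 + s) + 3 * (2 * 4 ^ s)     ≡⟨ *-distribˡ-+ 3 (f (1 + s)) (2 * 4 ^ s) ⟨
  3 * (f (1 + s) + 2 * 4 ^ s) ∎)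
  where
  identity : ∀ Q → 1 + 2 * (4 * Q) ≡ 1 + 2 * Q + 3 * (2 * Q)
  identity = solve-∀

2^[s*2]≡4^s : ∀ s → 2 ^ (s * 2) ≡ 4 ^ s
2^[s*2]≡4^s s = trans (cong (2 ^_) (*-comm s 2)) (sym (^-*-assoc 2 2 s))

cumReps-unfold : ∀ d {x} → fib (1 + d) ≤ x → x < fib (3 + d) → ∀ s →
  cumReps (1 + (s * 2 + d)) (fib (2 + (s * 2 + d)) + x) ≡ s * A x + f (suc s) * 2 ^ d + cumReps d x
cumReps-unfold d {x} lo hi zero = begin
  cumReps (1 + d) (fib (2 + d) + x)
    ≡⟨ cumReps-suc-≥ d (m≤m+n _ x) ⟩
  cumReps d (fib (2 + d) + x) + cumReps d (fib (2 + d) + x ∸ fib (2 + d))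
    ≡⟨ cong₂ _+_ (cumReps-full d (≤-trans (+-monoʳ-≤ (fib (2 + d)) lo) (m≤m+n _ 2)))
                 (cong (cumReps d) (m+n∸m≡n (fib (2 + d)) x)) ⟩
  2 ^ d + cumReps d x
    ≡⟨ cong (_+ cumReps d x) (sym (+-identityʳ (2 ^ d))) ⟩
  0 * A x + f 1 * 2 ^ d + cumReps d x ∎
cumReps-unfold d {x} lo hi (suc s) = begin
  cumReps (2 + p) (fib (3 + p) + x)
    ≡⟨ cumReps-fib-+ p x ⟩
  2 ^ p + cumReps p (fib (1 + p) + x) + cumReps (1 + p) x
    ≡⟨ cong₂ (λ a b → 2 ^ p + a + b) (cumReps-unfold d lo hi s) (sym (A≡cumReps (1 + p) x<F₃₊ₚ)) ⟩
  2 ^ p + (s * A x + f (1 + s) * 2 ^ d + cumReps d x) + A x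
    ≡⟨ cong (λ a → 2 * a + (s * A x + f (1 + s) * 2 ^ d + cumReps d x) + A x) 2^[s*2+d] ⟩
  2 * (4 ^ s * 2 ^ d) + (s * A x + f (1 + s) * 2 ^ d + cumReps d x) + A x
    ≡⟨ identity (A x) (s * A x) (f (1 + s)) (4 ^ s) (2 ^ d) (cumReps d x) ⟩
  A x + s * A x + (f (1 + s) + 2 * 4 ^ s) * 2 ^ d + cumReps d x
    ≡⟨ cong (λ a → A x + s * A x + a * 2 ^ d + cumReps d x) (f-suc s) ⟨
  suc s * A x + f (2 + s) * 2 ^ d + cumReps d x ∎
  where
  p = suc (s * 2 + d)
  x<F₃₊ₚ : x < fib (3 + p)
  x<F₃₊ₚ = <-≤-trans hi (fib-mono (+-monoʳ-≤ 3 (≤-trans (m≤n+m d (s * 2)) (n≤1+n _))))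
  2^[s*2+d] : 2 ^ (s * 2 + d) ≡ 4 ^ s * 2 ^ d
  2^[s*2+d] = trans (^-distribˡ-+-* 2 (s * 2) d) (cong (_* 2 ^ d) (2^[s*2]≡4^s s))
  identity : ∀ a sa φ Q D c → 2 * (Q * D) + (sa + φ * D + c) + a ≡ a + sa + (φ + 2 * Q) * D + c
  identity = solve-∀

A-fib-+ : ∀ s d {x} ε y → fib (1 + d) ≤ x → x < fib (3 + d) → cumReps d x + ε * A y ≡ A x →
  A (fib (2 * suc (suc s) + d) + x) + ε * A y ≡ suc (suc s) * A x + f (suc (suc s)) * 2 ^ d
A-fib-+ s d {x} ε y lo hi split = begin
  A (fib (2 * suc (suc s) + d) + x) + ε * A y
    ≡⟨ cong (λ n → A (fib n + x) + ε * A y) (cong (_+ d) (*-comm 2 (suc (suc s)))) ⟩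
  A (fib (2 + k) + x) + ε * A y
    ≡⟨ cong (_+ ε * A y) (A≡cumReps (1 + k) (+-monoʳ-< (fib (2 + k)) x<F₁₊ₖ)) ⟩
  cumReps (1 + k) (fib (2 + k) + x) + ε * A y
    ≡⟨ cong (_+ ε * A y) (cumReps-unfold d lo hi (suc s)) ⟩
  suc s * A x + f (2 + s) * 2 ^ d + cumReps d x + ε * A y
    ≡⟨ +-assoc _ (cumReps d x) (ε * A y) ⟩
  suc s * A x + f (2 + s) * 2 ^ d + (cumReps d x + ε * A y)
    ≡⟨ cong (_+_ (suc s * A x + f (2 + s) * 2 ^ d)) split ⟩
  suc s * A x + f (2 + s) * 2 ^ d + A x
    ≡⟨ identity (suc s * A x) (f (2 + s) * 2 ^ d) (A x) ⟩
  suc (suc s) * A x + f (2 + s) * 2 ^ d ∎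
  where
  k = suc s * 2 + d
  x<F₁₊ₖ : x < fib (1 + k)
  x<F₁₊ₖ = <-≤-trans hi (fib-mono (+-monoʳ-≤ 3 (m≤n+m d (s * 2))))
  identity : ∀ sa φ a → sa + φ + a ≡ a + sa + φ
  identity = solve-∀

cumReps+A≡A : ∀ d {x} → fib (2 + d) ≤ x → x < fib (3 + d) → cumReps d x + 1 * A (x ∸ fib (2 + d)) ≡ A x
cumReps+A≡A d {x} F≤x hi = begin
  cumReps d x + 1 * A y         ≡⟨ cong (_+_ (cumReps d x)) (*-identityˡ (A y)) ⟩
  cumReps d x + A y             ≡⟨ cong (_+_ (cumReps d x)) (A≡cumReps d (<-≤-trans y<F₁₊d (fib-≤-suc (1 + d)))) ⟩
  cumReps d x + cumReps d y     ≡⟨ cumReps-suc-≥ d F≤x ⟨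
  cumReps (1 + d) x             ≡⟨ A≡cumReps (1 + d) hi ⟨
  A x ∎
  where
  y = x ∸ fib (2 + d)
  y<F₁₊d : y < fib (1 + d)
  y<F₁₊d = +-cancelˡ-< (fib (2 + d)) y _ (subst (_< fib (3 + d)) (sym (m+[n∸m]≡n F≤x)) hi)

pos-≡-+-sub : ∀ a t b ε c z → a + ε * c ≡ t * b + z → + a ≡ (+ t *ℤ + b) - (+ ε *ℤ + c) +ℤ + z
pos-≡-+-sub a t b ε c z eq = begin
  + a                   ≡⟨ cancel (+ a) E ⟩
  (+ a +ℤ E) - E        ≡⟨ cong (_- E) eqℤ ⟩
  (T +ℤ + z) - E        ≡⟨ reorder T E (+ z) ⟩
  T - E +ℤ + z ∎
  where
  T = + t *ℤ + b
  E = + ε *ℤ + c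
  eqℤ : + a +ℤ E ≡ T +ℤ + z
  eqℤ = begin
    + a +ℤ E              ≡⟨ cong (+ a +ℤ_) (ℤ.pos-* ε c) ⟨
    + a +ℤ + (ε * c)      ≡⟨ ℤ.pos-+ a (ε * c) ⟨
    + (a + ε * c)         ≡⟨ cong +_ eq ⟩
    + (t * b + z)         ≡⟨ ℤ.pos-+ (t * b) z ⟩
    + (t * b) +ℤ + z      ≡⟨ cong (_+ℤ + z) (ℤ.pos-* t b) ⟩
    T +ℤ + z ∎
  cancel : ∀ X Y → X ≡ (X +ℤ Y) - Y
  cancel = ℤ-Solver.solve-∀
  reorder : ∀ X Y Z → (X +ℤ Z) - Y ≡ X - Y +ℤ Z
  reorder = ℤ-Solver.solve-∀

corollary3p3 : (t m x : ℕ) → 2 ≤ t → 2 * t ≤ m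
    → fib (m ∸ 2 * t + 1) ≤ x → x < fib (m ∸ 2 * t + 3)
    → ((fib (m ∸ 2 * t + 2) ≤ x)
        → + A (fib m + x) ≡ (+ t *ℤ + A x) - (+ 1 *ℤ + A (x ∸ fib (m ∸ 2 * t + 2))) +ℤ + (f t * 2 ^ (m ∸ 2 * t)))
      × ((x < fib (m ∸ 2 * t + 2))
        → + A (fib m + x) ≡ (+ t *ℤ + A x) - (+ 0 *ℤ + A (x ∸ fib (m ∸ 2 * t + 1))) +ℤ + (f t * 2 ^ (m ∸ 2 * t)))
corollary3p3 (suc (suc s)) m x (s≤s (s≤s z≤n)) 2t≤m with m≤n⇒∃[o]m+o≡n 2t≤m
... | d , refl rewrite m+n∸m≡n (2 * suc (suc s)) d | +-comm d 1 | +-comm d 2 | +-comm d 3 =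
  λ lo hi →
    (λ F≤x → pos-≡-+-sub _ t (A x) 1 (A y₂) z (A-fib-+ s d 1 y₂ lo hi (cumReps+A≡A d F≤x hi)))
  , (λ x<F → pos-≡-+-sub _ t (A x) 0 (A y₁) z (A-fib-+ s d 0 y₁ lo hi (cumReps+0≡A x<F)))
  where
  t = suc (suc s)
  z = f t * 2 ^ d
  y₁ = x ∸ fib (1 + d)
  y₂ = x ∸ fib (2 + d)
  cumReps+0≡A : x < fib (2 + d) → cumReps d x + 0 * A y₁ ≡ A x
  cumReps+0≡A x<F = trans (+-identityʳ _) (sym (A≡cumReps d x<F))
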